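{- Let $S$ be a connected unpseudoknotted secondary structure with strand ordering $\pi$ and $N$ total bases. If there exists at least one base pair $(i,j)\in S$ with $l[i,j]>\frac{N}{R}$, then $S$ cannot be $R$-fold rotationally symmetric.
   Context: Strands are words over $\{\mathrm{A},\mathrm{C},\mathrm{G},\mathrm{T}\}$; identical sequences have the same type. A circular ordering $\pi$ is a cyclic string over strand types; $v(\pi)$ is the largest $n$ with $\pi=y^n$ for a prefix $y$; $X^n_m$ is the $m$-th strand of type $X$ in the $n$-th copy of the shortest such prefix. The bases are indexed $1,\dots,N$ around a circle in the order $\pi$. A secondary structure $S$ is a set of base pairs between complementary bases (A–T, C–G), each base in at most one pair; in the polymer graph $\mathrm{Poly}(S,\pi)$ covalent bonds (consecutive bases of one strand) are arcs and base pairs are chords; unpseudoknotted means no two chords cross; connected means $\mathrm{Poly}(S,\pi)$ is connected. For bases $i,j$, $l[i,j]=\min\{|i-j|+1,N-|i-j|+1\}$ is the number of bases on the shorter circular arc from $i$ to $j$ (inclusive). $G^\pi$ is the cyclic group generated by the rotation sending base $i$ of $X^n_m$ to base $i$ of $X^{n+1\bmod v(\pi)}_m$; $S$ is $R$-fold rotationally symmetric if the largest subgroup $H\le G^\pi$ leaving $S$ invariant has order $R$. -}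

module Defs where

open import Data.Nat using (ℕ; zero; suc; _+_; _*_; _∸_; _<_; _≤_; ∣_-_∣; _⊓_)
open import Data.Nat.DivMod using (_mod_)
open import Data.Fin using (Fin; toℕ; _≟_)
open import Data.Fin.Properties using (all?)
open import Data.List using (List; []; _∷_; _++_; map; concat; replicate; length; lookup; filter; allFin)
open import Data.Maybe using (Maybe; just; nothing)
import Data.Maybe as M
open import Data.Maybe.Properties using (≡-dec)
open import Data.Product using (_×_; _,_; proj₁; proj₂)
open import Data.Sum using (_⊎_)
open import Data.Empty using (⊥)
open import Relation.Nullary using (Dec)
open import Relation.Binary.PropositionalEquality using (_≡_)
open import Relation.Binary.Construct.Closure.ReflexiveTransitive using (Star)

data Nuc : Set where
  A C G T : Nuc

Strand : Set
Strand = List Nuc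

data Complementary : Nuc → Nuc → Set where
  AT : Complementary A T
  TA : Complementary T A
  CG : Complementary C G
  GC : Complementary G C

-- A circular ordering π is represented by a linear representative: a list of
-- strand types, read cyclically.
labelsFrom : ℕ → List Strand → List (ℕ × Nuc)
labelsFrom k []       = []
labelsFrom k (s ∷ ss) = map (k ,_) s ++ labelsFrom (suc k) ss

labels : List Strand → List (ℕ × Nuc)
labels π = labelsFrom 0 π

numBases : List Strand → ℕ
numBases π = length (labels π)

-- bases are indexed 0,…,N-1 (the paper's 1,…,N shifted by one)
Base : List Strand → Set
Base π = Fin (numBases π)

nuc : (π : List Strand) → Base π → Nuc
nuc π i = proj₂ (lookup (labels π) i)

strandOf : (π : List Strand) → Base π → ℕ
strandOf π i = proj₁ (lookup (labels π) i)

IsPower : List Strand → List Strand → ℕ → Set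
IsPower π y n = π ≡ concat (replicate n y)

IsMaxPower : List Strand → List Strand → ℕ → Set
IsMaxPower π y v = IsPower π y v × (∀ n y′ → IsPower π y′ n → n ≤ v)

-- Secondary structure: a set of base pairs, each base in at most one pair,
-- encoded by the partner function (partner i ≡ just j iff (i,j) ∈ S).
record SecStruct (π : List Strand) : Set where
  field
    partner : Base π → Maybe (Base π)
    sym     : ∀ i j → partner i ≡ just j → partner j ≡ just i
    comp    : ∀ i j → partner i ≡ just j → Complementary (nuc π i) (nuc π j)
open SecStruct public

Paired : {π : List Strand} → SecStruct π → Base π → Base π → Set
Paired S i j = partner S i ≡ just j

Covalent : (π : List Strand) → Base π → Base π → Set
Covalent π i j = (toℕ j ≡ suc (toℕ i)) × (strandOf π i ≡ strandOf π j)

Edge : {π : List Strand} → SecStruct π → Base π → Base π → Set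
Edge {π} S i j = Covalent π i j ⊎ Covalent π j i ⊎ Paired S i j

Connected : {π : List Strand} → SecStruct π → Set
Connected {π} S = ∀ (i j : Base π) → Star (Edge S) i j

Unpseudoknotted : {π : List Strand} → SecStruct π → Set
Unpseudoknotted {π} S = ∀ (i j k l : Base π) → Paired S i j → Paired S k l →
  toℕ i < toℕ k → toℕ k < toℕ j → toℕ j < toℕ l → ⊥

arcLen : (π : List Strand) → Base π → Base π → ℕ
arcLen π i j = (∣ toℕ i - toℕ j ∣ + 1) ⊓ (numBases π ∸ ∣ toℕ i - toℕ j ∣ + 1)

shift : (N s : ℕ) → Fin N → Fin N
shift (suc n) s i = (toℕ i + s) mod suc n

-- ρ^k for ρ the generator of G^π: ρ sends base p to p + L (mod N), where L is the
-- number of bases in the shortest prefix y with π = y^{v(π)}.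
rot : (π y : List Strand) → ℕ → Base π → Base π
rot π y k = shift (numBases π) (k * length (concat y))

Fixes : (π y : List Strand) → SecStruct π → ℕ → Set
Fixes π y S k = ∀ i → partner S (rot π y k i) ≡ M.map (rot π y k) (partner S i)

fixes? : (π y : List Strand) (S : SecStruct π) (k : ℕ) → Dec (Fixes π y S k)
fixes? π y S k = all? (λ i → ≡-dec _≟_ (partner S (rot π y k i)) (M.map (rot π y k) (partner S i)))

-- G^π = {ρ^k : k < v(π)}; the largest subgroup leaving S invariant is the
-- stabiliser of S in G^π; its order:
symOrder : (π y : List Strand) → ℕ → SecStruct π → ℕ
symOrder π y v S = length (filter (λ (k : Fin v) → fixes? π y S (toℕ k)) (allFin v))

RotSymmetric : (π y : List Strand) (v : ℕ) → SecStruct π → ℕ → Set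
RotSymmetric π y v S R = symOrder π y v S ≡ R

{-# OPTIONS --safe #-}
module Submission where

-- The rotations ρᵏ (k < v) fixing S are closed under differences, and there
-- are R of them; adding k = v, the pigeonhole principle gives a < b among them
-- with (b − a) R ≤ v.  Hence S is invariant under the rotation by
-- s = (b − a) L ≤ N / R bases, L = |y|, and s < l[i,j] for the given pair.
-- That rotation carries the chord (i,j) to a chord crossing it, unless the two
-- chords share an endpoint; this forces j = i + s, so that i is paired with
-- an identical base (the sequence is L-periodic), which no Watson–Crick pair
-- allows.

open import Defs hiding (sym)
open import Data.Nat using (ℕ; zero; suc; _+_; _*_; _∸_; _<_; _≤_; _<?_; s≤s⁻¹; NonZero; >-nonZero; ∣_-_∣; _⊓_)
open import Data.Nat.Properties
open import Data.Nat.DivMod using (_/_; _%_; m≡m%n+[m/n]*n; m%n<n; m<n*o⇒m/o<n; m<n⇒m%n≡m; m≤n⇒[n∸m]%m≡n%m; %-distribˡ-+; m%n%n≡m%n; [m+kn]%n≡m%n)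
open import Data.Fin using (Fin; toℕ; fromℕ<)
open import Data.Fin.Properties using (toℕ-injective; toℕ-fromℕ<; toℕ<n; pigeonhole)
open import Data.List using (List; []; _∷_; _++_; map; concat; replicate; length; lookup; filter; allFin)
open import Data.List.Properties using (map-++; map-∘; map-id; length-++; length-map; concat-concat; map-replicate; ++-assoc; ++-identityʳ)
import Data.List.Relation.Unary.All as All
open import Data.List.Relation.Unary.All.Properties using (all-filter)
open import Data.List.Relation.Unary.AllPairs using (_∷_)
open import Data.List.Relation.Unary.Unique.Propositional using (Unique)
open import Data.List.Relation.Unary.Unique.Propositional.Properties using (allFin⁺; filter⁺)
open import Data.List.Membership.Propositional.Properties using (∈-lookup)
open import Data.Maybe using (Maybe; just; nothing)
import Data.Maybe as Maybe
import Data.Maybe.Properties as Maybe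
open import Data.Product using (Σ; ∃-syntax; ∃₂; _×_; _,_; proj₂; uncurry′)
open import Data.Sum using (inj₁; inj₂)
open import Data.Empty using (⊥)
open import Function using (_∘_)
open import Function.Definitions using (Injective)
open import Relation.Nullary using (¬_; Dec; yes; no; contradiction)
open import Relation.Binary.Definitions using (tri<; tri≈; tri>)
open import Relation.Binary.PropositionalEquality

private
  variable
    X Y : Set

nth : List X → ℕ → Maybe X
nth []       _       = nothing
nth (x ∷ xs) zero    = just x
nth (x ∷ xs) (suc n) = nth xs n

nth-lookup : (xs : List X) (i : Fin (length xs)) → nth xs (toℕ i) ≡ just (lookup xs i)
nth-lookup (x ∷ xs) Fin.zero    = refl
nth-lookup (x ∷ xs) (Fin.suc i) = nth-lookup xs i

nth-map : (f : X → Y) (xs : List X) (n : ℕ) → nth (map f xs) n ≡ Maybe.map f (nth xs n)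
nth-map f []       n       = refl
nth-map f (x ∷ xs) zero    = refl
nth-map f (x ∷ xs) (suc n) = nth-map f xs n

nth-++ʳ : (xs ys : List X) (n : ℕ) → nth (xs ++ ys) (length xs + n) ≡ nth ys n
nth-++ʳ []       ys n = refl
nth-++ʳ (x ∷ xs) ys n = nth-++ʳ xs ys n

nth-++ˡ : (xs ys : List X) (n : ℕ) {z : X} → nth xs n ≡ just z → nth (xs ++ ys) n ≡ just z
nth-++ˡ []       ys n       ()
nth-++ˡ (x ∷ xs) ys zero    e = e
nth-++ˡ (x ∷ xs) ys (suc n) e = nth-++ˡ xs ys n e

lookup-injective : {xs : List X} → Unique xs → Injective _≡_ _≡_ (lookup xs)
lookup-injective (_ ∷ _)    {Fin.zero}  {Fin.zero}  _ = refl
lookup-injective (x≢ ∷ _)   {Fin.zero}  {Fin.suc j} e = contradiction e (All.lookup x≢ (∈-lookup j))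
lookup-injective (x≢ ∷ _)   {Fin.suc i} {Fin.zero}  e = contradiction (sym e) (All.lookup x≢ (∈-lookup i))
lookup-injective (_ ∷ uxs)  {Fin.suc i} {Fin.suc j} e = cong Fin.suc (lookup-injective uxs e)

power : ℕ → List X → List X
power v w = concat (replicate v w)

length-power : ∀ v (w : List X) → length (power v w) ≡ v * length w
length-power zero    w = refl
length-power (suc v) w = trans (length-++ w) (cong (length w +_) (length-power v w))

power-++-comm : ∀ v (w : List X) → power v w ++ w ≡ w ++ power v w
power-++-comm zero    w = sym (++-identityʳ w)
power-++-comm (suc v) w = trans (++-assoc w (power v w) w) (cong (w ++_) (power-++-comm v w))

nth-power-periodic : ∀ v (w : List X) p {z : X} →
  nth (power v w) (length w + p) ≡ just z → nth (power v w) p ≡ just z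
nth-power-periodic zero    w p ()
nth-power-periodic (suc v) w p {z} e =
  subst (λ u → nth u p ≡ just z) (power-++-comm v w)
    (nth-++ˡ (power v w) w p (trans (sym (nth-++ʳ w (power v w) p)) e))

nth-power-periodic* : ∀ v (w : List X) m p {z : X} →
  nth (power v w) (m * length w + p) ≡ just z → nth (power v w) p ≡ just z
nth-power-periodic* v w zero    p e = e
nth-power-periodic* v w (suc m) p {z} e = nth-power-periodic* v w m p
  (nth-power-periodic v w (m * length w + p) (subst (λ n → nth (power v w) n ≡ just z) (+-assoc (length w) _ p) e))

map-proj₂-labelsFrom : ∀ k (π : List Strand) → map proj₂ (labelsFrom k π) ≡ concat π
map-proj₂-labelsFrom k []      = refl
map-proj₂-labelsFrom k (s ∷ π) = begin
  map proj₂ (map (k ,_) s ++ labelsFrom (suc k) π)               ≡⟨ map-++ proj₂ (map (k ,_) s) _ ⟩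
  map proj₂ (map (k ,_) s) ++ map proj₂ (labelsFrom (suc k) π)   ≡⟨ cong₂ _++_ (trans (sym (map-∘ s)) (map-id s))
                                                                               (map-proj₂-labelsFrom (suc k) π) ⟩
  s ++ concat π                                                  ∎
  where open ≡-Reasoning

nth-concat : (π : List Strand) (i : Base π) → nth (concat π) (toℕ i) ≡ just (nuc π i)
nth-concat π i = begin
  nth (concat π) (toℕ i)                    ≡⟨ cong (λ w → nth w (toℕ i)) (sym (map-proj₂-labelsFrom 0 π)) ⟩
  nth (map proj₂ (labels π)) (toℕ i)        ≡⟨ nth-map proj₂ (labels π) (toℕ i) ⟩
  Maybe.map proj₂ (nth (labels π) (toℕ i))  ≡⟨ cong (Maybe.map proj₂) (nth-lookup (labels π) i) ⟩
  just (nuc π i)                            ∎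
  where open ≡-Reasoning

numBases≡length-concat : (π : List Strand) → numBases π ≡ length (concat π)
numBases≡length-concat π = trans (sym (length-map proj₂ (labels π))) (cong length (map-proj₂-labelsFrom 0 π))

concat-power : ∀ {π} y v → IsPower π y v → concat π ≡ power v (concat y)
concat-power y v refl = trans (sym (concat-concat (replicate v y))) (cong concat (map-replicate concat v y))

numBases-power : ∀ {π} y v → IsPower π y v → numBases π ≡ v * length (concat y)
numBases-power {π} y v π≡yᵛ =
  trans (numBases≡length-concat π) (trans (cong length (concat-power y v π≡yᵛ)) (length-power v (concat y)))

nuc-periodic : ∀ {π} y v → IsPower π y v → ∀ m (p q : Base π) →
  toℕ q ≡ toℕ p + m * length (concat y) → nuc π q ≡ nuc π p
nuc-periodic {π} y v π≡yᵛ m p q q≡p+mL =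
  Maybe.just-injective (trans (sym (nth-power-periodic* v w m (toℕ p) q-entry)) (entry p))
  where
  w : List Nuc
  w = concat y
  entry : ∀ r → nth (power v w) (toℕ r) ≡ just (nuc π r)
  entry r = subst (λ u → nth u (toℕ r) ≡ just (nuc π r)) (concat-power y v π≡yᵛ) (nth-concat π r)
  q-entry : nth (power v w) (m * length w + toℕ p) ≡ just (nuc π q)
  q-entry = subst (λ n → nth (power v w) n ≡ just (nuc π q)) (trans q≡p+mL (+-comm (toℕ p) _)) (entry q)

toℕ-shift : ∀ {n} s (i : Fin (suc n)) → toℕ (shift (suc n) s i) ≡ (toℕ i + s) % suc n
toℕ-shift s i = toℕ-fromℕ< _

toℕ-shift-< : ∀ {N} s (i : Fin N) → toℕ i + s < N → toℕ (shift N s i) ≡ toℕ i + s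
toℕ-shift-< {suc n} s i i+s<N = trans (toℕ-shift s i) (m<n⇒m%n≡m i+s<N)

toℕ-shift-≥ : ∀ {N} s (i : Fin N) → N ≤ toℕ i + s → toℕ i + s < N + N → toℕ (shift N s i) ≡ toℕ i + s ∸ N
toℕ-shift-≥ {suc n} s i N≤i+s i+s<2N = begin
  toℕ (shift (suc n) s i)       ≡⟨ toℕ-shift s i ⟩
  (toℕ i + s) % suc n           ≡⟨ m≤n⇒[n∸m]%m≡n%m N≤i+s ⟨
  (toℕ i + s ∸ suc n) % suc n   ≡⟨ m<n⇒m%n≡m (m<n+o⇒m∸n<o (toℕ i + s) (suc n) i+s<2N) ⟩
  toℕ i + s ∸ suc n             ∎
  where open ≡-Reasoning

shift-0 : ∀ {N} (i : Fin N) → shift N 0 i ≡ i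
shift-0 {suc n} i = toℕ-injective (trans (toℕ-shift 0 i)
  (trans (cong (_% suc n) (+-identityʳ (toℕ i))) (m<n⇒m%n≡m (toℕ<n i))))

shift-+ : ∀ {N} a b (i : Fin N) → shift N b (shift N a i) ≡ shift N (a + b) i
shift-+ {suc n} a b i = toℕ-injective (begin
  toℕ (shift (suc n) b (shift (suc n) a i))   ≡⟨ toℕ-shift b (shift (suc n) a i) ⟩
  (toℕ (shift (suc n) a i) + b) % suc n       ≡⟨ cong (λ k → (k + b) % suc n) (toℕ-shift a i) ⟩
  ((toℕ i + a) % suc n + b) % suc n           ≡⟨ %-distribˡ-+ ((toℕ i + a) % suc n) b (suc n) ⟩
  ((toℕ i + a) % suc n % suc n + b % suc n) % suc n
                                              ≡⟨ cong (λ k → (k + b % suc n) % suc n) (m%n%n≡m%n (toℕ i + a) (suc n)) ⟩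
  ((toℕ i + a) % suc n + b % suc n) % suc n   ≡⟨ %-distribˡ-+ (toℕ i + a) b (suc n) ⟨
  (toℕ i + a + b) % suc n                     ≡⟨ cong (_% suc n) (+-assoc (toℕ i) a b) ⟩
  (toℕ i + (a + b)) % suc n                   ≡⟨ toℕ-shift (a + b) i ⟨
  toℕ (shift (suc n) (a + b) i)               ∎)
  where open ≡-Reasoning

shift-+-*N : ∀ {N} s t (i : Fin N) → shift N (s + t * N) i ≡ shift N s i
shift-+-*N {suc n} s t i = toℕ-injective (begin
  toℕ (shift (suc n) (s + t * suc n) i)   ≡⟨ toℕ-shift (s + t * suc n) i ⟩
  (toℕ i + (s + t * suc n)) % suc n       ≡⟨ cong (_% suc n) (+-assoc (toℕ i) s (t * suc n)) ⟨
  (toℕ i + s + t * suc n) % suc n         ≡⟨ [m+kn]%n≡m%n (toℕ i + s) t (suc n) ⟩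
  (toℕ i + s) % suc n                     ≡⟨ toℕ-shift s i ⟨
  toℕ (shift (suc n) s i)                 ∎)
  where open ≡-Reasoning

-- Subtracting a is adding (N − 1) a modulo N, which keeps us within ℕ.
shift-∸ : ∀ {N} a b (i : Fin N) → a ≤ b → shift N (b + (N ∸ 1) * a) i ≡ shift N (b ∸ a) i
shift-∸ {suc n} a b i a≤b = trans (cong (λ k → shift (suc n) k i) b+na≡[b∸a]+a[1+n]) (shift-+-*N (b ∸ a) a i)
  where
  open ≡-Reasoning
  b+na≡[b∸a]+a[1+n] : b + n * a ≡ (b ∸ a) + a * suc n
  b+na≡[b∸a]+a[1+n] = begin
    b + n * a               ≡⟨ cong (_+ n * a) (m∸n+n≡m a≤b) ⟨
    (b ∸ a) + a + n * a     ≡⟨ +-assoc (b ∸ a) a (n * a) ⟩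
    (b ∸ a) + suc n * a     ≡⟨ cong ((b ∸ a) +_) (*-comm (suc n) a) ⟩
    (b ∸ a) + a * suc n     ∎

-- Fixes π y S k unfolds to Invariant S (k * length (concat y)).
Invariant : {π : List Strand} → SecStruct π → ℕ → Set
Invariant {π} S s = ∀ i → partner S (shift (numBases π) s i) ≡ Maybe.map (shift (numBases π) s) (partner S i)

module _ {π : List Strand} (S : SecStruct π) where

  private
    N : ℕ
    N = numBases π

  invariant-cong : ∀ {a b} → (∀ i → shift N a i ≡ shift N b i) → Invariant S a → Invariant S b
  invariant-cong {a} {b} a≗b inv i = begin
    partner S (shift N b i)               ≡⟨ cong (partner S) (a≗b i) ⟨
    partner S (shift N a i)               ≡⟨ inv i ⟩
    Maybe.map (shift N a) (partner S i)   ≡⟨ Maybe.map-cong a≗b (partner S i) ⟩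
    Maybe.map (shift N b) (partner S i)   ∎
    where open ≡-Reasoning

  invariant-0 : Invariant S 0
  invariant-0 i = begin
    partner S (shift N 0 i)               ≡⟨ cong (partner S) (shift-0 i) ⟩
    partner S i                           ≡⟨ Maybe.map-id (partner S i) ⟨
    Maybe.map (λ j → j) (partner S i)     ≡⟨ Maybe.map-cong (sym ∘ shift-0) (partner S i) ⟩
    Maybe.map (shift N 0) (partner S i)   ∎
    where open ≡-Reasoning

  invariant-+ : ∀ {a b} → Invariant S a → Invariant S b → Invariant S (a + b)
  invariant-+ {a} {b} inv-a inv-b i = begin
    partner S (shift N (a + b) i)                             ≡⟨ cong (partner S) (shift-+ a b i) ⟨
    partner S (shift N b (shift N a i))                       ≡⟨ inv-b (shift N a i) ⟩
    Maybe.map (shift N b) (partner S (shift N a i))           ≡⟨ cong (Maybe.map (shift N b)) (inv-a i) ⟩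
    Maybe.map (shift N b) (Maybe.map (shift N a) (partner S i)) ≡⟨ Maybe.map-∘ (partner S i) ⟨
    Maybe.map (shift N b ∘ shift N a) (partner S i)           ≡⟨ Maybe.map-cong (shift-+ a b) (partner S i) ⟩
    Maybe.map (shift N (a + b)) (partner S i)                 ∎
    where open ≡-Reasoning

  invariant-* : ∀ t {a} → Invariant S a → Invariant S (t * a)
  invariant-* zero    inv = invariant-0
  invariant-* (suc t) inv = invariant-+ inv (invariant-* t inv)

  invariant-*N : ∀ t → Invariant S (t * N)
  invariant-*N t = invariant-cong (λ i → sym (shift-+-*N 0 t i)) invariant-0

  invariant-∸ : ∀ {a b} → a ≤ b → Invariant S a → Invariant S b → Invariant S (b ∸ a)
  invariant-∸ {a} {b} a≤b inv-a inv-b =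
    invariant-cong (λ i → shift-∸ a b i a≤b) (invariant-+ inv-b (invariant-* (N ∸ 1) inv-a))

  Paired-shift : ∀ {s i j} → Invariant S s → Paired S i j → Paired S (shift N s i) (shift N s j)
  Paired-shift {s} {i} inv i~j = trans (inv i) (cong (Maybe.map (shift N s)) i~j)

m/o≡n/o⇒n∸m<o : ∀ m n o .{{_ : NonZero o}} → m / o ≡ n / o → n ∸ m < o
m/o≡n/o⇒n∸m<o m n o m/o≡n/o = ≤-<-trans (begin
  n ∸ m                                   ≡⟨ cong₂ _∸_ (m≡m%n+[m/n]*n n o) m≡m%o+[n/o]*o ⟩
  (n % o + n / o * o) ∸ (m % o + n / o * o) ≡⟨ cong₂ _∸_ (+-comm (n % o) _) (+-comm (m % o) _) ⟩
  (n / o * o + n % o) ∸ (n / o * o + m % o) ≡⟨ [m+n]∸[m+o]≡n∸o (n / o * o) (n % o) (m % o) ⟩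
  n % o ∸ m % o                           ≤⟨ m∸n≤m (n % o) (m % o) ⟩
  n % o                                   ∎) (m%n<n n o)
  where
  open ≤-Reasoning
  m≡m%o+[n/o]*o : m ≡ m % o + n / o * o
  m≡m%o+[n/o]*o = trans (m≡m%n+[m/n]*n m o) (cong (λ q → m % o + q * o) m/o≡n/o)

-- Buckets ⌊g t · m / (v + 1)⌋ < m: two of the m + 1 values share one.
pigeonhole-gap : ∀ {m} v .{{_ : NonZero m}} (g : Fin (suc m) → ℕ) → Injective _≡_ _≡_ g → (∀ t → g t ≤ v) →
  ∃₂ λ t u → g t < g u × (g u ∸ g t) * m ≤ v
pigeonhole-gap {m} v g g-injective g≤v = order (pigeonhole (n<1+n m) bucket)
  where
  open ≤-Reasoning
  bucket< : ∀ t → g t * m / suc v < m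
  bucket< t = m<n*o⇒m/o<n (begin-strict
    g t * m     ≤⟨ *-monoˡ-≤ m (g≤v t) ⟩
    v * m       <⟨ *-monoˡ-< m (n<1+n v) ⟩
    suc v * m   ≡⟨ *-comm (suc v) m ⟩
    m * suc v   ∎)
  bucket : Fin (suc m) → Fin m
  bucket t = fromℕ< (bucket< t)
  gap : ∀ t u → bucket t ≡ bucket u → (g u ∸ g t) * m ≤ v
  gap t u same = s≤s⁻¹ (begin-strict
    (g u ∸ g t) * m      ≡⟨ *-distribʳ-∸ m (g u) (g t) ⟩
    g u * m ∸ g t * m    <⟨ m/o≡n/o⇒n∸m<o (g t * m) (g u * m) (suc v)
                              (trans (sym (toℕ-fromℕ< (bucket< t))) (trans (cong toℕ same) (toℕ-fromℕ< (bucket< u)))) ⟩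
    suc v                ∎)
  order : (∃₂ λ t u → t Data.Fin.< u × bucket t ≡ bucket u) → ∃₂ λ t u → g t < g u × (g u ∸ g t) * m ≤ v
  order (t , u , t<u , same) with <-cmp (g t) (g u)
  ... | tri< gt<gu _ _ = t , u , gt<gu , gap t u same
  ... | tri> _ _ gu<gt = u , t , gu<gt , gap u t (sym same)
  ... | tri≈ _ gt≡gu _ = contradiction (cong toℕ (g-injective gt≡gu)) (<⇒≢ t<u)

RotSymmetric⇒short-invariant-shift : ∀ {π} y v → IsPower π y v → (S : SecStruct π) (R : ℕ) .{{_ : NonZero R}} →
  RotSymmetric π y v S R → ∃[ d ] 0 < d × d * R ≤ v × Invariant S (d * length (concat y))
RotSymmetric⇒short-invariant-shift {π} y v π≡yᵛ S _ refl =
  let t , u , gt<gu , gap = pigeonhole-gap v g g-injective g≤v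
  in g u ∸ g t , m<n⇒0<n∸m gt<gu , gap ,
     subst (Invariant S) (sym (*-distribʳ-∸ L (g u) (g t)))
           (invariant-∸ S (*-monoˡ-≤ L (<⇒≤ gt<gu)) (g-invariant t) (g-invariant u))
  where
  L : ℕ
  L = length (concat y)
  fixes : (k : Fin v) → Dec (Fixes π y S (toℕ k))
  fixes k = fixes? π y S (toℕ k)
  stabiliser : List (Fin v)
  stabiliser = filter fixes (allFin v)
  g : Fin (suc (length stabiliser)) → ℕ
  g Fin.zero    = v
  g (Fin.suc t) = toℕ (lookup stabiliser t)
  g≤v : ∀ t → g t ≤ v
  g≤v Fin.zero    = ≤-refl
  g≤v (Fin.suc t) = <⇒≤ (toℕ<n (lookup stabiliser t))
  g-injective : Injective _≡_ _≡_ g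
  g-injective {Fin.zero}  {Fin.zero}  _ = refl
  g-injective {Fin.zero}  {Fin.suc u} e = contradiction e (<⇒≢ (toℕ<n (lookup stabiliser u)) ∘ sym)
  g-injective {Fin.suc t} {Fin.zero}  e = contradiction e (<⇒≢ (toℕ<n (lookup stabiliser t)))
  g-injective {Fin.suc t} {Fin.suc u} e =
    cong Fin.suc (lookup-injective (filter⁺ fixes (allFin⁺ v)) (toℕ-injective e))
  g-invariant : ∀ t → Invariant S (g t * L)
  g-invariant Fin.zero    = subst (Invariant S) (trans (*-identityˡ _) (numBases-power y v π≡yᵛ)) (invariant-*N S 1)
  g-invariant (Fin.suc t) = All.lookup (all-filter fixes (allFin v)) (∈-lookup t)

Complementary⇒≢ : ∀ {x y} → Complementary x y → x ≢ y
Complementary⇒≢ AT ()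
Complementary⇒≢ TA ()
Complementary⇒≢ CG ()
Complementary⇒≢ GC ()

arcLen-sym : (π : List Strand) (i j : Base π) → arcLen π i j ≡ arcLen π j i
arcLen-sym π i j = cong (λ D → (D + 1) ⊓ (numBases π ∸ D + 1)) (∣-∣-comm (toℕ i) (toℕ j))

<arcLen⇒spanning : ∀ {π} s (i j : Base π) → s < arcLen π i j → toℕ i ≤ toℕ j →
  toℕ i + s ≤ toℕ j × toℕ j + s ≤ numBases π + toℕ i
<arcLen⇒spanning {π} s i j s<l i≤j = subst (_≤ toℕ j) (+-comm s (toℕ i)) (m≤o∸n⇒m+n≤o s i≤j s≤D) , j+s≤N+i
  where
  open ≤-Reasoning
  N D : ℕ
  N = numBases π
  D = toℕ j ∸ toℕ i
  ∣i-j∣≡D : ∣ toℕ i - toℕ j ∣ ≡ D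
  ∣i-j∣≡D = m≤n⇒∣m-n∣≡n∸m i≤j
  <+1⇒≤ : ∀ {m} n → m < n + 1 → m ≤ n
  <+1⇒≤ {m} n m<n+1 = m<1+n⇒m≤n (subst (m <_) (+-comm n 1) m<n+1)
  s≤D : s ≤ D
  s≤D = <+1⇒≤ D (subst (λ e → s < e + 1) ∣i-j∣≡D (<-≤-trans s<l (m⊓n≤m _ _)))
  s≤N∸D : s ≤ N ∸ D
  s≤N∸D = <+1⇒≤ (N ∸ D) (subst (λ e → s < N ∸ e + 1) ∣i-j∣≡D (<-≤-trans s<l (m⊓n≤n _ _)))
  j+s≤N+i : toℕ j + s ≤ N + toℕ i
  j+s≤N+i = begin
    toℕ j + s               ≡⟨ +-comm (toℕ j) s ⟩
    s + toℕ j               ≡⟨ cong (s +_) (m∸n+n≡m i≤j) ⟨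
    s + (D + toℕ i)         ≡⟨ +-assoc s D (toℕ i) ⟨
    s + D + toℕ i           ≤⟨ +-monoˡ-≤ (toℕ i) (m≤o∸n⇒m+n≤o s (≤-trans (m∸n≤m (toℕ j) (toℕ i)) (<⇒≤ (toℕ<n j))) s≤N∸D) ⟩
    N + toℕ i               ∎

module _ {π : List Strand} (S : SecStruct π) (unknotted : Unpseudoknotted S)
         (s : ℕ) (0<s : 0 < s) (invariant : Invariant S s)
         (periodic : ∀ (p q : Base π) → toℕ q ≡ toℕ p + s → nuc π q ≡ nuc π p) where

  private
    N : ℕ
    N = numBases π

  -- With i′ = i + s and j′ = j + s mod N: either i < i′ < j < j′, or
  -- j′ < i < i′ < j, or j′ = i, which makes j = i′.
  no-chord-strictly-spanning-shift : ∀ {i j} → Paired S i j → toℕ i + s < toℕ j → toℕ j + s ≤ N + toℕ i → ⊥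
  no-chord-strictly-spanning-shift {i} {j} i~j i+s<j j+s≤N+i = wrap-or-not (toℕ j + s <? N)
    where
    i′ j′ : Base π
    i′ = shift N s i
    j′ = shift N s j
    i′~j′ : Paired S i′ j′
    i′~j′ = Paired-shift S invariant i~j
    s<N : s < N
    s<N = ≤-<-trans (m≤n+m s (toℕ i)) (<-trans i+s<j (toℕ<n j))
    i′≡i+s : toℕ i′ ≡ toℕ i + s
    i′≡i+s = toℕ-shift-< s i (<-trans i+s<j (toℕ<n j))
    i<i′ : toℕ i < toℕ i′
    i<i′ = subst (toℕ i <_) (sym i′≡i+s) (m<m+n (toℕ i) 0<s)
    i′<j : toℕ i′ < toℕ j
    i′<j = subst (_< toℕ j) (sym i′≡i+s) i+s<j
    wrap-or-not : Dec (toℕ j + s < N) → ⊥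
    wrap-or-not (yes j+s<N) =
      unknotted i j i′ j′ i~j i′~j′ i<i′ i′<j (subst (toℕ j <_) (sym (toℕ-shift-< s j j+s<N)) (m<m+n (toℕ j) 0<s))
    wrap-or-not (no j+s≮N) with m≤n⇒m<n∨m≡n j′≤i
      where
      j′≡j+s∸N : toℕ j′ ≡ toℕ j + s ∸ N
      j′≡j+s∸N = toℕ-shift-≥ s j (≮⇒≥ j+s≮N) (+-mono-< (toℕ<n j) s<N)
      j′≤i : toℕ j′ ≤ toℕ i
      j′≤i = subst (_≤ toℕ i) (sym j′≡j+s∸N) (m≤n+o⇒m∸n≤o (toℕ j + s) N j+s≤N+i)
    ... | inj₁ j′<i = unknotted j′ i′ i j (SecStruct.sym S i′ j′ i′~j′) i~j j′<i i<i′ i′<j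
    ... | inj₂ j′≡i = <-irrefl (cong toℕ i′≡j) i′<j
      where
      i~i′ : Paired S i i′
      i~i′ = SecStruct.sym S i′ i (subst (Paired S i′) (toℕ-injective j′≡i) i′~j′)
      i′≡j : i′ ≡ j
      i′≡j = Maybe.just-injective (trans (sym i~i′) i~j)

  no-chord-spanning-shift : ∀ {i j} → Paired S i j → toℕ i + s ≤ toℕ j → toℕ j + s ≤ N + toℕ i → ⊥
  no-chord-spanning-shift {i} {j} i~j i+s≤j j+s≤N+i with m≤n⇒m<n∨m≡n i+s≤j
  ... | inj₁ i+s<j = no-chord-strictly-spanning-shift i~j i+s<j j+s≤N+i
  ... | inj₂ i+s≡j = Complementary⇒≢ (comp S i j i~j) (sym (periodic i j (sym i+s≡j)))

  no-chord-longer-than-shift : ∀ {i j} → Paired S i j → s < arcLen π i j → ⊥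
  no-chord-longer-than-shift {i} {j} i~j s<l with ≤-total (toℕ i) (toℕ j)
  ... | inj₁ i≤j = uncurry′ (no-chord-spanning-shift i~j) (<arcLen⇒spanning {π} s i j s<l i≤j)
  ... | inj₂ j≤i = uncurry′ (no-chord-spanning-shift (SecStruct.sym S i j i~j))
                           (<arcLen⇒spanning {π} s j i (subst (s <_) (arcLen-sym π i j) s<l) j≤i)

lemma13 : (π y : List Strand) (v : ℕ) → IsMaxPower π y v →
    (S : SecStruct π) → Connected S → Unpseudoknotted S →
    (R : ℕ) →
    Σ (Base π) (λ i → Σ (Base π) (λ j → Paired S i j × numBases π < arcLen π i j * R)) →
    ¬ RotSymmetric π y v S R
lemma13 π y v (π≡yᵛ , _) S _ unknotted R (i , j , i~j , N<l*R) R-fold =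
  let d , 0<d , d*R≤v , invariant = RotSymmetric⇒short-invariant-shift y v π≡yᵛ S R R-fold
  in no-chord-longer-than-shift S unknotted (d * L) (0<d*L d 0<d) invariant (nuc-periodic y v π≡yᵛ d) i~j
       (d*L<l d d*R≤v)
  where
  open ≤-Reasoning
  N L : ℕ
  N = numBases π
  L = length (concat y)
  instance
    R≢0 : NonZero R
    R≢0 = m*n≢0⇒n≢0 (arcLen π i j) {{>-nonZero (m<n⇒0<n N<l*R)}}
  N≡vL : N ≡ v * L
  N≡vL = numBases-power y v π≡yᵛ
  0<L : 0 < L
  0<L = n≢0⇒n>0 λ L≡0 → n≮0 (subst (toℕ i <_) (trans N≡vL (trans (cong (v *_) L≡0) (*-zeroʳ v))) (toℕ<n i))
  0<d*L : ∀ d → 0 < d → 0 < d * L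
  0<d*L d 0<d = *-mono-≤ 0<d 0<L
  d*L<l : ∀ d → d * R ≤ v → d * L < arcLen π i j
  d*L<l d d*R≤v = *-cancelʳ-< R (d * L) (arcLen π i j) (≤-<-trans (begin
    d * L * R     ≡⟨ *-assoc d L R ⟩
    d * (L * R)   ≡⟨ cong (d *_) (*-comm L R) ⟩
    d * (R * L)   ≡⟨ *-assoc d R L ⟨
    d * R * L     ≤⟨ *-monoˡ-≤ L d*R≤v ⟩
    v * L         ≡⟨ N≡vL ⟨
    N             ∎) N<l*R)
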